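{- Let $m\in\mathbb{Q}$ and let $f^{(n)}_m(X)$ and $r^{(n)}(X)$ be the polynomials defined in the context. Then for every $\alpha\in\mathbb{C}$ and every $n\geq 1$, $$(X+\alpha+1)^n\, f^{(n)}_m\!\left(\frac{\alpha X-1}{X+\alpha+1}\right)=f^{(n)}_m(\alpha)\, f^{(n)}_m(X)-(m^2+m+1)\, r^{(n)}(\alpha)\, r^{(n)}(X).$$
   Context: For a rational number $m$ define $g,h:\mathbb{N}\to\mathbb{Q}$ by: $g(i)=1,\,-m,\,-m-1,\,-1,\,m,\,m+1$ according as $i\equiv 0,1,2,3,4,5 \pmod 6$, and $h(i)=0,\,-1,\,-1,\,0,\,1,\,1$ according as $i\equiv 0,1,2,3,4,5\pmod 6$. For $n\geq 0$ put $f^{(n)}_m(X)=\sum_{i=0}^{n}\binom{n}{i}X^i g(n-i)$ and $r^{(n)}(X)=\sum_{i=0}^{n}\binom{n}{i}X^i h(n-i)$. -}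

module Defs where

open import Level using (Level)
open import Data.Nat as ℕ using (ℕ; zero; suc; _%_)
open import Data.Nat.Combinatorics using (_C_)
open import Algebra.Bundles using (CommutativeRing; Semiring)
import Algebra.Definitions.RawSemiring as RS

module Poly {c ℓ : Level} (R : CommutativeRing c ℓ) where
  open CommutativeRing R hiding (zero)
  open RS (Semiring.rawSemiring semiring) using (_×_; _^_) public

  sumUpTo : ℕ → (ℕ → Carrier) → Carrier
  sumUpTo zero    t = t zero
  sumUpTo (suc n) t = sumUpTo n t + t (suc n)

  gAux : Carrier → ℕ → Carrier
  gAux m 0 = 1#
  gAux m 1 = - m
  gAux m 2 = - m - 1#
  gAux m 3 = - 1#
  gAux m 4 = m
  gAux m _ = m + 1#

  g : Carrier → ℕ → Carrier
  g m i = gAux m (i % 6)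

  hAux : ℕ → Carrier
  hAux 0 = 0#
  hAux 1 = - 1#
  hAux 2 = - 1#
  hAux 3 = 0#
  hAux 4 = 1#
  hAux _ = 1#

  h : ℕ → Carrier
  h i = hAux (i % 6)

  f : Carrier → ℕ → Carrier → Carrier
  f m n x = sumUpTo n (λ i → ((n C i) × (x ^ i)) * g m (n ℕ.∸ i))

  r : ℕ → Carrier → Carrier
  r n x = sumUpTo n (λ i → ((n C i) × (x ^ i)) * h (n ℕ.∸ i))

  -- Z^n f^{(n)}_m(Y / Z), with the denominator cleared termwise:
  -- Σ_{i=0}^n C(n,i) Y^i Z^(n-i) g(n-i)
  fHom : Carrier → ℕ → Carrier → Carrier → Carrier
  fHom m n Y Z = sumUpTo n (λ i → ((n C i) × (Y ^ i)) * (Z ^ (n ℕ.∸ i)) * g m (n ℕ.∸ i))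

-- The sequences g and h satisfy s (k + 2) = s (k + 1) − s k.  In R[ζ] with ζ² = ζ − 1 the
-- functional eval s (a + bζ) = a s₀ + b s₁ therefore sends ζ^k to s k, and Pascal's rule gives
-- Σᵢ C(n,i) Y^i Z^(n−i) s (n−i) = eval s ((Y + Zζ)^n).  As
-- (α + ζ)(X + ζ) = (αX − 1) + (X + α + 1)ζ, the left-hand side is eval g ((α + ζ)^n (X + ζ)^n),
-- and since eval g (a + bζ) = a − m b and eval h (a + bζ) = − b, a direct computation gives
-- eval g (u v) = eval g u · eval g v − (m² + m + 1) · eval h u · eval h v.
module Submission where

open import Level using (Level)
open import Algebra.Bundles using (CommutativeRing)
open import Data.Maybe using (Maybe; just; nothing)
open import Data.Nat as ℕ using (ℕ; zero; suc; _∸_; _%_; _≥_)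
import Data.Nat.Properties as ℕ
open import Data.Nat.DivMod using ([m+n]%n≡m%n)
open import Data.Nat.Combinatorics using (_C_; nCk+nC[k+1]≡[n+1]C[k+1]; k>n⇒nCk≡0)
open import Data.Integer as ℤ using (ℤ; +_; -[1+_]; _⊖_; _◃_)
import Data.Integer.Properties as ℤ
import Data.Sign as Sign
open import Data.Fin using (Fin; toℕ)
open import Data.Fin.Patterns using (0F; 1F; 2F; 3F; 4F; 5F)
open import Data.Product using (_,_; proj₁; proj₂) renaming (_×_ to _×ₚ_)
open import Data.Product.Relation.Binary.Pointwise.NonDependent using (×-setoid)
open import Function using (_∘_)
open import Relation.Binary.PropositionalEquality as ≡ using (_≡_)
open import Relation.Binary.Bundles using (Setoid)
open import Relation.Nullary using (yes; no)
open import Defs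

-- The canonical ring homomorphism ℤ → R turns the ring solver for
-- integer coefficients into a solver for an arbitrary commutative ring.
module IntegerCoefficients {c ℓ : Level} (R : CommutativeRing c ℓ) where
  open CommutativeRing R
  open import Relation.Binary.Reasoning.Setoid setoid
  open import Algebra.Properties.Ring ring
    using (-0#≈0#; -‿distribˡ-*; -‿distribʳ-*; -‿involutive; -‿+-comm)
  open import Algebra.Properties.Semiring.Mult.TCOptimised semiring
    using (_×_; 1+×; ×-homo-+; ×1-homo-*)
  open import Algebra.Properties.CommutativeSemigroup +-commutativeSemigroup
    using (interchange)
  open import Algebra.Solver.Ring.AlmostCommutativeRing
    using (_-Raw-AlmostCommutative⟶_; fromCommutativeRing)

  ι : ℤ → Carrier
  ι (+ n)      = n × 1#
  ι -[1+ n ]   = - (suc n × 1#)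

  ι-⊖ : ∀ m n → ι (m ⊖ n) ≈ m × 1# - n × 1#
  ι-⊖ m zero = begin
    ι (m ⊖ 0)       ≡⟨ ≡.cong ι (ℤ.⊖-≥ {m} {0} ℕ.z≤n) ⟩
    m × 1#          ≈⟨ +-identityʳ _ ⟨
    m × 1# + 0#     ≈⟨ +-congˡ -0#≈0# ⟨
    m × 1# - 0#     ∎
  ι-⊖ zero (suc n) = begin
    ι (0 ⊖ suc n)   ≡⟨ ≡.cong ι (ℤ.⊖-< {0} {suc n} (ℕ.s≤s ℕ.z≤n)) ⟩
    - (suc n × 1#)  ≈⟨ +-identityˡ _ ⟨
    0# - suc n × 1# ∎
  ι-⊖ (suc m) (suc n) = begin
    ι (suc m ⊖ suc n)                ≡⟨ ≡.cong ι (ℤ.[1+m]⊖[1+n]≡m⊖n m n) ⟩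
    ι (m ⊖ n)                        ≈⟨ ι-⊖ m n ⟩
    m × 1# - n × 1#                  ≈⟨ +-identityˡ _ ⟨
    0# + (m × 1# - n × 1#)           ≈⟨ +-congʳ (-‿inverseʳ 1#) ⟨
    (1# - 1#) + (m × 1# - n × 1#)    ≈⟨ interchange _ _ _ _ ⟩
    (1# + m × 1#) + (- 1# - n × 1#)  ≈⟨ +-congˡ (-‿+-comm _ _) ⟩
    (1# + m × 1#) - (1# + n × 1#)    ≈⟨ +-cong (1+× m 1#) (-‿cong (1+× n 1#)) ⟨
    suc m × 1# - suc n × 1#          ∎

  ι-+ : ∀ i j → ι (i ℤ.+ j) ≈ ι i + ι j
  ι-+ (+ m)      (+ n)      = ×-homo-+ 1# m n
  ι-+ (+ m)      -[1+ n ]   = ι-⊖ m (suc n)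
  ι-+ -[1+ m ]   (+ n)      = trans (ι-⊖ n (suc m)) (+-comm _ _)
  ι-+ -[1+ m ]   -[1+ n ]   = begin
    - (suc (suc (m ℕ.+ n)) × 1#)          ≡⟨ ≡.cong (λ k → - (suc k × 1#)) (ℕ.+-suc m n) ⟨
    - ((suc m ℕ.+ suc n) × 1#)            ≈⟨ -‿cong (×-homo-+ 1# (suc m) (suc n)) ⟩
    - (suc m × 1# + suc n × 1#)           ≈⟨ -‿+-comm _ _ ⟨
    - (suc m × 1#) - suc n × 1#           ∎

  ι-◃⁺ : ∀ n → ι (Sign.+ ◃ n) ≈ n × 1#
  ι-◃⁺ n = reflexive (≡.cong ι (ℤ.+◃n≡+n n))

  ι-◃⁻ : ∀ n → ι (Sign.- ◃ n) ≈ - (n × 1#)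
  ι-◃⁻ zero    = sym -0#≈0#
  ι-◃⁻ (suc n) = refl

  ι-* : ∀ i j → ι (i ℤ.* j) ≈ ι i * ι j
  ι-* (+ m)      (+ n)      = trans (ι-◃⁺ (m ℕ.* n)) (×1-homo-* m n)
  ι-* (+ m)      -[1+ n ]   =
    trans (ι-◃⁻ (m ℕ.* suc n)) (trans (-‿cong (×1-homo-* m (suc n))) (-‿distribʳ-* _ _))
  ι-* -[1+ m ]   (+ n)      =
    trans (ι-◃⁻ (suc m ℕ.* n)) (trans (-‿cong (×1-homo-* (suc m) n)) (-‿distribˡ-* _ _))
  ι-* -[1+ m ]   -[1+ n ]   = begin
    ι (+ (suc m ℕ.* suc n))        ≈⟨ ×1-homo-* (suc m) (suc n) ⟩
    a * b                          ≈⟨ -‿involutive _ ⟨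
    - - (a * b)                    ≈⟨ -‿cong (-‿distribʳ-* a b) ⟩
    - (a * - b)                    ≈⟨ -‿distribˡ-* a (- b) ⟩
    - a * - b                      ∎
    where a = suc m × 1#; b = suc n × 1#

  ι-neg : ∀ i → ι (ℤ.- i) ≈ - ι i
  ι-neg (+ zero)  = sym -0#≈0#
  ι-neg (+ suc n) = refl
  ι-neg -[1+ n ]  = sym (-‿involutive _)

  ι-homomorphism : CommutativeRing.rawRing ℤ.+-*-commutativeRing
                     -Raw-AlmostCommutative⟶ fromCommutativeRing R
  ι-homomorphism = record
    { ⟦_⟧ = ι ; +-homo = ι-+ ; *-homo = ι-* ; -‿homo = ι-neg ; 0-homo = refl ; 1-homo = refl }

  ι-≟ : ∀ i j → Maybe (ι i ≈ ι j)
  ι-≟ i j with i ℤ.≟ j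
  ... | yes ≡.refl = just refl
  ... | no _       = nothing

  open import Algebra.Solver.Ring _ _ ι-homomorphism ι-≟ public

module BinomialSums {c ℓ : Level} (R : CommutativeRing c ℓ) where
  open CommutativeRing R
  open Poly R
  open IntegerCoefficients R using (solve; _:=_; _:+_; _:*_)
  open import Relation.Binary.Reasoning.Setoid setoid
  open import Algebra.Properties.Semiring.Mult semiring using (×-homo-+; ×-comm-*)

  sumUpTo-cong : ∀ n {t u : ℕ → Carrier} → (∀ i → t i ≈ u i) → sumUpTo n t ≈ sumUpTo n u
  sumUpTo-cong zero    t≈u = t≈u 0
  sumUpTo-cong (suc n) t≈u = +-cong (sumUpTo-cong n t≈u) (t≈u (suc n))

  sumUpTo-distrib-+ : ∀ n (t u : ℕ → Carrier) →
                      sumUpTo n (λ i → t i + u i) ≈ sumUpTo n t + sumUpTo n u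
  sumUpTo-distrib-+ zero    t u = refl
  sumUpTo-distrib-+ (suc n) t u = trans (+-congʳ (sumUpTo-distrib-+ n t u))
    (solve 4 (λ a b c d → (a :+ b) :+ (c :+ d) := (a :+ c) :+ (b :+ d)) refl _ _ _ _)

  *-distribˡ-sumUpTo : ∀ n a (t : ℕ → Carrier) → sumUpTo n (λ i → a * t i) ≈ a * sumUpTo n t
  *-distribˡ-sumUpTo zero    a t = refl
  *-distribˡ-sumUpTo (suc n) a t = trans (+-congʳ (*-distribˡ-sumUpTo n a t)) (sym (distribˡ _ _ _))

  sumUpTo-unfoldˡ : ∀ n (t : ℕ → Carrier) → sumUpTo (suc n) t ≈ t 0 + sumUpTo n (t ∘ suc)
  sumUpTo-unfoldˡ zero    t = refl
  sumUpTo-unfoldˡ (suc n) t = trans (+-congʳ (sumUpTo-unfoldˡ n t)) (+-assoc _ _ _)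

  binomialTerm : Carrier → Carrier → ℕ → (ℕ → Carrier) → ℕ → Carrier
  binomialTerm Y Z n s i = ((n C i) × (Y ^ i)) * (Z ^ (n ∸ i)) * s (n ∸ i)

  binomialSum : Carrier → Carrier → ℕ → (ℕ → Carrier) → Carrier
  binomialSum Y Z n s = sumUpTo n (binomialTerm Y Z n s)

  binomialSum-1# : ∀ Y n s →
    binomialSum Y 1# n s ≈ sumUpTo n (λ i → ((n C i) × (Y ^ i)) * s (n ∸ i))
  binomialSum-1# Y n s =
    sumUpTo-cong n (λ i → *-congʳ (trans (*-congˡ (1#^n≈1# (n ∸ i))) (*-identityʳ _)))
    where
    1#^n≈1# : ∀ k → 1# ^ k ≈ 1#
    1#^n≈1# zero    = refl
    1#^n≈1# (suc k) = trans (*-identityˡ _) (1#^n≈1# k)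

  binomialTerm-beyond : ∀ Y Z n s → binomialTerm Y Z n s (suc n) ≈ 0#
  binomialTerm-beyond Y Z n s rewrite k>n⇒nCk≡0 (ℕ.n<1+n n) = trans (*-congʳ (zeroˡ _)) (zeroˡ _)

  binomialTerm-head : ∀ Y Z n s → binomialTerm Y Z (suc n) s 0 ≈ Z * binomialTerm Y Z n (s ∘ suc) 0
  binomialTerm-head Y Z n s =
    solve 4 (λ a Z W V → a :* (Z :* W) :* V := Z :* (a :* W :* V)) refl _ Z (Z ^ n) (s (suc n))

  m>n⇒m∸n≡suc[m∸suc[n]] : ∀ {m n} → n ℕ.< m → m ∸ n ≡ suc (m ∸ suc n)
  m>n⇒m∸n≡suc[m∸suc[n]] {suc m} {zero}  _           = ≡.refl
  m>n⇒m∸n≡suc[m∸suc[n]] {suc m} {suc n} (ℕ.s≤s n<m) = m>n⇒m∸n≡suc[m∸suc[n]] n<m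

  binomialTerm-pascal : ∀ Y Z n s i →
    binomialTerm Y Z (suc n) s (suc i)
      ≈ Y * binomialTerm Y Z n s i + Z * binomialTerm Y Z n (s ∘ suc) (suc i)
  binomialTerm-pascal Y Z n s i = begin
    ((suc n C suc i) × (Y * Y ^ i)) * W * V
      ≡⟨ ≡.cong (λ k → (k × (Y * Y ^ i)) * W * V) (nCk+nC[k+1]≡[n+1]C[k+1] n i) ⟨
    ((n C i ℕ.+ n C suc i) × (Y * Y ^ i)) * W * V
      ≈⟨ *-congʳ (*-congʳ (×-homo-+ _ (n C i) (n C suc i))) ⟩
    ((n C i) × (Y * Y ^ i) + B) * W * V
      ≈⟨ *-congʳ (*-congʳ (+-congʳ (×-comm-* (n C i) Y (Y ^ i)))) ⟨
    (Y * A + B) * W * V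
      ≈⟨ solve 5 (λ Y A B W V → (Y :* A :+ B) :* W :* V := Y :* (A :* W :* V) :+ B :* W :* V)
                 refl Y A B W V ⟩
    Y * (A * W * V) + B * W * V
      ≈⟨ +-congˡ shifted ⟩
    Y * binomialTerm Y Z n s i + Z * binomialTerm Y Z n (s ∘ suc) (suc i) ∎
    where
    A = (n C i) × (Y ^ i)
    B = (n C suc i) × (Y * Y ^ i)
    W = Z ^ (n ∸ i)
    V = s (n ∸ i)
    -- For i < n one factor Z splits off W; otherwise n C suc i = 0 and both sides vanish.
    shifted : B * W * V ≈ Z * binomialTerm Y Z n (s ∘ suc) (suc i)
    shifted with i ℕ.<? n
    ... | yes i<n rewrite m>n⇒m∸n≡suc[m∸suc[n]] i<n =
      solve 4 (λ B Z W V → B :* (Z :* W) :* V := Z :* (B :* W :* V)) refl B Z _ _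
    ... | no i≮n rewrite k>n⇒nCk≡0 (ℕ.s≤s (ℕ.≮⇒≥ i≮n)) =
      trans (trans (*-congʳ (zeroˡ _)) (zeroˡ _))
            (sym (trans (*-congˡ (trans (*-congʳ (zeroˡ _)) (zeroˡ _))) (zeroʳ Z)))

  binomialSum-suc : ∀ Y Z n s →
    binomialSum Y Z (suc n) s ≈ Y * binomialSum Y Z n s + Z * binomialSum Y Z n (s ∘ suc)
  binomialSum-suc Y Z n s = begin
    binomialSum Y Z (suc n) s
      ≈⟨ sumUpTo-unfoldˡ n (binomialTerm Y Z (suc n) s) ⟩
    binomialTerm Y Z (suc n) s 0 + sumUpTo n (binomialTerm Y Z (suc n) s ∘ suc)
      ≈⟨ +-cong (binomialTerm-head Y Z n s)
                (trans (sumUpTo-cong n (binomialTerm-pascal Y Z n s))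
                       (sumUpTo-distrib-+ n _ _)) ⟩
    Z * t′ 0 + (sumUpTo n (λ i → Y * t i) + sumUpTo n (λ i → Z * t′ (suc i)))
      ≈⟨ +-congˡ (+-cong (*-distribˡ-sumUpTo n Y t) (*-distribˡ-sumUpTo n Z (t′ ∘ suc))) ⟩
    Z * t′ 0 + (Y * binomialSum Y Z n s + Z * S′)
      ≈⟨ solve 4 (λ Z a b c → Z :* a :+ (b :+ Z :* c) := b :+ Z :* (a :+ c)) refl Z (t′ 0) _ S′ ⟩
    Y * binomialSum Y Z n s + Z * (t′ 0 + S′)
      ≈⟨ +-congˡ (*-congˡ (sumUpTo-unfoldˡ n t′)) ⟨
    Y * binomialSum Y Z n s + Z * sumUpTo (suc n) t′
      ≈⟨ +-congˡ (*-congˡ (trans (+-congˡ (binomialTerm-beyond Y Z n (s ∘ suc))) (+-identityʳ _))) ⟩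
    Y * binomialSum Y Z n s + Z * binomialSum Y Z n (s ∘ suc) ∎
    where
    t  = binomialTerm Y Z n s
    t′ = binomialTerm Y Z n (s ∘ suc)
    S′ = sumUpTo n (t′ ∘ suc)

-- (a , b) stands for a + bζ, where ζ is a primitive sixth root of unity.
module AdjoinSixthRoot {c ℓ : Level} (R : CommutativeRing c ℓ) where
  open CommutativeRing R
  open BinomialSums R using (binomialSum; binomialSum-suc)
  open IntegerCoefficients R using (Polynomial; solve; _:=_; _:+_; _:*_; _:-_; con)
  open import Relation.Binary.Reasoning.Setoid setoid

  R[ζ] : Set c
  R[ζ] = Carrier ×ₚ Carrier

  ≋-setoid : Setoid c ℓ
  ≋-setoid = ×-setoid setoid setoid

  open Setoid ≋-setoid public using ()
    renaming (_≈_ to _≋_; refl to ≋-refl; sym to ≋-sym; trans to ≋-trans)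

  infixl 7 _·_
  _·_ : R[ζ] → R[ζ] → R[ζ]
  (a , b) · (a′ , b′) = (a * a′ - b * b′ , a * b′ + b * a′ + b * b′)

  infixl 7 _⊛_
  _⊛_ : ∀ {k} → Polynomial k ×ₚ Polynomial k → Polynomial k ×ₚ Polynomial k →
        Polynomial k ×ₚ Polynomial k
  (a , b) ⊛ (a′ , b′) = (a :* a′ :- b :* b′ , a :* b′ :+ b :* a′ :+ b :* b′)

  infixr 8 _^ζ_
  _^ζ_ : R[ζ] → ℕ → R[ζ]
  u ^ζ zero  = (1# , 0#)
  u ^ζ suc n = u · u ^ζ n

  ·-cong : ∀ {u u′ v v′} → u ≋ u′ → v ≋ v′ → u · v ≋ u′ · v′
  ·-cong (a≈ , b≈) (c≈ , d≈) =
    +-cong (*-cong a≈ c≈) (-‿cong (*-cong b≈ d≈)) ,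
    +-cong (+-cong (*-cong a≈ d≈) (*-cong b≈ c≈)) (*-cong b≈ d≈)

  ·-identityˡ : ∀ u → (1# , 0#) · u ≋ u
  ·-identityˡ (a , b) =
    solve 2 (λ a b → con (+ 1) :* a :- con (+ 0) :* b := a) refl a b ,
    solve 2 (λ a b → con (+ 1) :* b :+ con (+ 0) :* a :+ con (+ 0) :* b := b) refl a b

  ^ζ-cong : ∀ {u v} → u ≋ v → ∀ n → u ^ζ n ≋ v ^ζ n
  ^ζ-cong u≋v zero    = ≋-refl
  ^ζ-cong u≋v (suc n) = ·-cong u≋v (^ζ-cong u≋v n)

  ·-interchange : ∀ u v u′ v′ → (u · v) · (u′ · v′) ≋ (u · u′) · (v · v′)
  ·-interchange (a , b) (c , d) (a′ , b′) (c′ , d′) =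
    solve 8 (λ a b c d a′ b′ c′ d′ →
               proj₁ (lhs a b c d a′ b′ c′ d′) := proj₁ (rhs a b c d a′ b′ c′ d′))
      refl a b c d a′ b′ c′ d′ ,
    solve 8 (λ a b c d a′ b′ c′ d′ →
               proj₂ (lhs a b c d a′ b′ c′ d′) := proj₂ (rhs a b c d a′ b′ c′ d′))
      refl a b c d a′ b′ c′ d′
    where
    lhs rhs : ∀ {k} (a b c d a′ b′ c′ d′ : Polynomial k) → Polynomial k ×ₚ Polynomial k
    lhs a b c d a′ b′ c′ d′ = ((a , b) ⊛ (c , d)) ⊛ ((a′ , b′) ⊛ (c′ , d′))
    rhs a b c d a′ b′ c′ d′ = ((a , b) ⊛ (a′ , b′)) ⊛ ((c , d) ⊛ (c′ , d′))

  ^ζ-distrib-· : ∀ u v n → (u · v) ^ζ n ≋ u ^ζ n · v ^ζ n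
  ^ζ-distrib-· u v zero    = ≋-sym (·-identityˡ (1# , 0#))
  ^ζ-distrib-· u v (suc n) =
    ≋-trans (·-cong (≋-refl {u · v}) (^ζ-distrib-· u v n)) (·-interchange u v (u ^ζ n) (v ^ζ n))

  Recurrent : (ℕ → Carrier) → Set ℓ
  Recurrent s = ∀ k → s (2 ℕ.+ k) ≈ s (1 ℕ.+ k) - s k

  eval : (ℕ → Carrier) → R[ζ] → Carrier
  eval s (a , b) = a * s 0 + b * s 1

  eval-cong : ∀ s {u v} → u ≋ v → eval s u ≈ eval s v
  eval-cong s (a≈ , b≈) = +-cong (*-congʳ a≈) (*-congʳ b≈)

  eval-· : ∀ {s} → Recurrent s → ∀ Y Z u →
           eval s ((Y , Z) · u) ≈ Y * eval s u + Z * eval (s ∘ suc) u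
  eval-· {s} rec Y Z (a , b) = begin
    (Y * a - Z * b) * s 0 + (Y * b + Z * a + Z * b) * s 1
      ≈⟨ solve 6 (λ Y Z a b s₀ s₁ →
           (Y :* a :- Z :* b) :* s₀ :+ (Y :* b :+ Z :* a :+ Z :* b) :* s₁
             := Y :* (a :* s₀ :+ b :* s₁) :+ Z :* (a :* s₁ :+ b :* (s₁ :- s₀)))
           refl Y Z a b (s 0) (s 1) ⟩
    Y * (a * s 0 + b * s 1) + Z * (a * s 1 + b * (s 1 - s 0))
      ≈⟨ +-congˡ (*-congˡ (+-congˡ (*-congˡ (rec 0)))) ⟨
    Y * (a * s 0 + b * s 1) + Z * (a * s 1 + b * s 2) ∎

  binomialSum≈eval : ∀ {s} → Recurrent s → ∀ Y Z n → binomialSum Y Z n s ≈ eval s ((Y , Z) ^ζ n)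
  binomialSum≈eval {s} rec Y Z zero =
    solve 2 (λ s₀ s₁ → (con (+ 1) :+ con (+ 0)) :* con (+ 1) :* s₀
                         := con (+ 1) :* s₀ :+ con (+ 0) :* s₁)
      refl (s 0) (s 1)
  binomialSum≈eval {s} rec Y Z (suc n) = begin
    binomialSum Y Z (suc n) s                          ≈⟨ binomialSum-suc Y Z n s ⟩
    Y * binomialSum Y Z n s + Z * binomialSum Y Z n (s ∘ suc)
      ≈⟨ +-cong (*-congˡ (binomialSum≈eval rec Y Z n))
                (*-congˡ (binomialSum≈eval (rec ∘ suc) Y Z n)) ⟩
    Y * eval s w + Z * eval (s ∘ suc) w                ≈⟨ eval-· rec Y Z w ⟨
    eval s ((Y , Z) · w)                               ∎
    where w = (Y , Z) ^ζ n

module PolynomialsInR[ζ] {c ℓ : Level} (R : CommutativeRing c ℓ) where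
  open CommutativeRing R
  open Poly R
  open BinomialSums R using (binomialSum-1#)
  open AdjoinSixthRoot R
  open IntegerCoefficients R using (solve; _:=_; _:+_; _:*_; _:-_; :-_; con)
  open import Relation.Binary.Reasoning.Setoid setoid

  recurrent-mod6 : ∀ (a : ℕ → Carrier) → let s = a ∘ (_% 6) in
    (∀ (j : Fin 6) → s (2 ℕ.+ toℕ j) ≈ s (1 ℕ.+ toℕ j) - s (toℕ j)) → Recurrent s
  recurrent-mod6 a base 0 = base 0F
  recurrent-mod6 a base 1 = base 1F
  recurrent-mod6 a base 2 = base 2F
  recurrent-mod6 a base 3 = base 3F
  recurrent-mod6 a base 4 = base 4F
  recurrent-mod6 a base 5 = base 5F
  recurrent-mod6 a base (suc (suc (suc (suc (suc (suc k)))))) = begin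
    s (6 ℕ.+ (2 ℕ.+ k))              ≡⟨ period (2 ℕ.+ k) ⟩
    s (2 ℕ.+ k)                      ≈⟨ recurrent-mod6 a base k ⟩
    s (1 ℕ.+ k) - s k                ≡⟨ ≡.cong₂ _-_ (period (1 ℕ.+ k)) (period k) ⟨
    s (6 ℕ.+ (1 ℕ.+ k)) - s (6 ℕ.+ k) ∎
    where
    s = a ∘ (_% 6)
    period : ∀ j → s (6 ℕ.+ j) ≡ s j
    period j = ≡.cong a (≡.trans (≡.cong (_% 6) (ℕ.+-comm 6 j)) ([m+n]%n≡m%n j 6))

  g-recurrent : ∀ m → Recurrent (g m)
  g-recurrent m = recurrent-mod6 (gAux m) λ where
    0F → refl
    1F → solve 1 (λ m → :- con (+ 1) := (:- m :- con (+ 1)) :- (:- m)) refl m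
    2F → solve 1 (λ m → m := :- con (+ 1) :- (:- m :- con (+ 1))) refl m
    3F → solve 1 (λ m → m :+ con (+ 1) := m :- (:- con (+ 1))) refl m
    4F → solve 1 (λ m → con (+ 1) := (m :+ con (+ 1)) :- m) refl m
    5F → solve 1 (λ m → :- m := con (+ 1) :- (m :+ con (+ 1))) refl m

  h-recurrent : Recurrent h
  h-recurrent = recurrent-mod6 hAux λ where
    0F → solve 0 (:- con (+ 1) := :- con (+ 1) :- con (+ 0)) refl
    1F → solve 0 (con (+ 0) := :- con (+ 1) :- (:- con (+ 1))) refl
    2F → solve 0 (con (+ 1) := con (+ 0) :- (:- con (+ 1))) refl
    3F → solve 0 (con (+ 1) := con (+ 1) :- con (+ 0)) refl
    4F → solve 0 (con (+ 0) := con (+ 1) :- con (+ 1)) refl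
    5F → solve 0 (:- con (+ 1) := con (+ 0) :- con (+ 1)) refl

  f≈eval : ∀ m n x → f m n x ≈ eval (g m) ((x , 1#) ^ζ n)
  f≈eval m n x = trans (sym (binomialSum-1# x n (g m))) (binomialSum≈eval (g-recurrent m) x 1# n)

  r≈eval : ∀ n x → r n x ≈ eval h ((x , 1#) ^ζ n)
  r≈eval n x = trans (sym (binomialSum-1# x n h)) (binomialSum≈eval h-recurrent x 1# n)

  eval-g-· : ∀ m u v → eval (g m) (u · v)
             ≈ eval (g m) u * eval (g m) v - (m * m + m + 1#) * eval h u * eval h v
  eval-g-· m (a , b) (c , d) = solve 5 (λ m a b c d →
      proj₁ ((a , b) ⊛ (c , d)) :* con (+ 1) :+ proj₂ ((a , b) ⊛ (c , d)) :* (:- m)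
        := (a :* con (+ 1) :+ b :* (:- m)) :* (c :* con (+ 1) :+ d :* (:- m))
           :- (m :* m :+ m :+ con (+ 1)) :* (a :* con (+ 0) :+ b :* (:- con (+ 1)))
                                         :* (c :* con (+ 0) :+ d :* (:- con (+ 1))))
    refl m a b c d

  ζ-factorisation : ∀ α X → (α , 1#) · (X , 1#) ≋ (α * X - 1# , X + α + 1#)
  ζ-factorisation α X =
    solve 2 (λ α X → α :* X :- con (+ 1) :* con (+ 1) := α :* X :- con (+ 1)) refl α X ,
    solve 2 (λ α X → α :* con (+ 1) :+ con (+ 1) :* X :+ con (+ 1) :* con (+ 1)
                       := X :+ α :+ con (+ 1)) refl α X

-- The identity holds for n = 0 as well.
mainTheorem2 : {c ℓ : Level} (R : CommutativeRing c ℓ) →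
    let open CommutativeRing R in
    let open Poly R in
    (m α X : Carrier) (n : ℕ) → n ≥ 1 →
    fHom m n (α * X - 1#) (X + α + 1#)
      ≈ f m n α * f m n X - (m * m + m + 1#) * r n α * r n X
mainTheorem2 R m α X n _ = begin
  fHom m n (α * X - 1#) (X + α + 1#)
    ≈⟨ binomialSum≈eval (g-recurrent m) _ _ n ⟩
  eval (g m) ((α * X - 1# , X + α + 1#) ^ζ n)
    ≈⟨ eval-cong (g m) (≋-trans (^ζ-cong (≋-sym (ζ-factorisation α X)) n) (^ζ-distrib-· _ _ n)) ⟩
  eval (g m) (A · B)
    ≈⟨ eval-g-· m A B ⟩
  eval (g m) A * eval (g m) B - (m * m + m + 1#) * eval h A * eval h B
    ≈⟨ +-cong (*-cong (f≈eval m n α) (f≈eval m n X))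
              (-‿cong (*-cong (*-congˡ (r≈eval n α)) (r≈eval n X))) ⟨
  f m n α * f m n X - (m * m + m + 1#) * r n α * r n X ∎
  where
  open CommutativeRing R
  open Poly R
  open AdjoinSixthRoot R
  open PolynomialsInR[ζ] R
  open import Relation.Binary.Reasoning.Setoid setoid
  A = (α , 1#) ^ζ n
  B = (X , 1#) ^ζ n
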